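{- Let $n,k,m$ be integers with $k<n<2k$ and $2\le m\le k$, and let $\mathbf a=a_1\cdots a_n$ be a vertex of $G(n)$ contained in at least one closed $k$-walk. Let $y_{\mathbf a}=y_1\cdots y_{n-1}=\mathrm{st}(a_2\cdots a_n)$ and $z_{\mathbf a}=z_1\cdots z_{n-k+1}=\mathrm{st}(a_1\cdots a_{n-k+1})$. Suppose that either (i) $z_{n-k+1}=1$ and each of $1,\dots,m-1$ occurs among $y_1,\dots,y_{k-1}$, or (ii) $z_{n-k+1}=n-k+1$ and each of $n-m+1,\dots,n-1$ occurs among $y_1,\dots,y_{k-1}$. Then there exist $m$ closed $k$-walks $(\mathbf a,\mathbf b^{(r)},\dots)$, $r=1,\dots,m$, starting at $\mathbf a$ whose second vertices $\mathbf b^{(1)},\dots,\mathbf b^{(m)}$ are pairwise distinct.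
   Context: For a sequence of distinct integers $c_1\cdots c_t$, $\mathrm{st}(c_1\cdots c_t)$ is the unique permutation $d_1\cdots d_t$ of $\{1,\dots,t\}$ with $d_i<d_j$ iff $c_i<c_j$. $G(n)$ is the directed multigraph whose vertices are the permutations of $\{1,\dots,n\}$ (one-line notation) and whose edges are the permutations $c_1\cdots c_{n+1}$ of $\{1,\dots,n+1\}$, the edge $c_1\cdots c_{n+1}$ going from $\mathrm{st}(c_1\cdots c_n)$ to $\mathrm{st}(c_2\cdots c_{n+1})$; so there is an edge from $x_1\cdots x_n$ to $w_1\cdots w_n$ iff $\mathrm{st}(x_2\cdots x_n)=\mathrm{st}(w_1\cdots w_{n-1})$. A closed $k$-walk $(v_1,\dots,v_k)$ is a sequence of vertices with an edge from $v_i$ to $v_{i+1}$ for $i<k$ and from $v_k$ to $v_1$. -}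

module Defs where

open import Data.Nat using (ℕ; zero; suc; _<_; _≤_; _∸_; _+_; _<?_)
open import Data.List using (List; []; _∷_; map; length; upTo; take; drop; _++_; [_]; filter)
open import Data.List.Relation.Binary.Permutation.Propositional using (_↭_)
open import Data.List.Relation.Unary.Linked using (Linked)
open import Data.List.Membership.Propositional using (_∈_)
open import Data.Empty using (⊥)
open import Data.List.Relation.Unary.All using (All)
open import Data.Product using (Σ; _×_)
open import Relation.Binary.PropositionalEquality using (_≡_)

IsPerm : ℕ → List ℕ → Set
IsPerm n xs = xs ↭ map suc (upTo n)

-- Standardization: st(c)_i = 1 + #{ j : c_j < c_i } (meaningful for distinct entries).
st : List ℕ → List ℕ
st cs = map (λ c → suc (length (filter (_<? c) cs))) cs

Edge : ℕ → List ℕ → List ℕ → Set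
Edge n x w = Σ (List ℕ) λ c → IsPerm (suc n) c × (st (take n c) ≡ x) × (st (drop 1 c) ≡ w)

ClosedWalk : ℕ → ℕ → List (List ℕ) → Set
ClosedWalk n k [] = ⊥
ClosedWalk n k (v ∷ vs) =
  (length (v ∷ vs) ≡ k) × All (IsPerm n) (v ∷ vs)
    × Linked (Edge n) ((v ∷ vs) ++ [ v ])

-- A closed k-walk through a forces the periodicity st(a_{k+1} ⋯ aₙ) = st(a₁ ⋯ a_{n-k}).  Conversely,
-- any sequence c₀ ⋯ c_{n+k-1} of distinct numbers whose length-n windows at 0 and at k both
-- standardise to a gives a closed k-walk through a, namely its successive windows; its second vertex
-- st(c₁ ⋯ cₙ) ends with 1 + #{1 ≤ i < n : cᵢ < cₙ}.  Such a sequence is obtained by interleaving a with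
-- a copy shifted by k, and the freedom lies in placing cₙ among the first-window values sharing its
-- position relative to the overlap.  In case (i) cₙ lies below every overlap value; so do the entries
-- of a₂ ⋯ aₙ with y-values 1, …, m-1, since by hypothesis they sit in a₂ ⋯ a_k; hence cₙ can be placed
-- above exactly θ of them for each θ < m.  Case (ii) is the mirror image at the top.  The m resulting
-- second vertices differ in their last entry.

module Submission where

open import Defs
open import Data.Nat using (ℕ; zero; suc; _<_; _≤_; _∸_; _+_; _*_; _⊓_; _<?_; _≤?_; z≤n; s≤s; z<s; s<s)
open import Data.Nat.Properties
open import Data.Fin using (Fin; toℕ)
open import Data.Fin.Properties using (toℕ<n; toℕ-injective)
open import Data.List using (List; []; _∷_; _++_; [_]; _∷ʳ_; map; length; upTo; applyUpTo; take; drop; head; filter)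
open import Data.List.Properties
  using (map-∘; map-id; map-id-local; map-cong-local; map-upTo; length-map; length-++; length-drop; length-upTo; length-applyUpTo;
         filter-++; filter-all; length-filter; take-[]; length-take; take-take; ++-assoc; filter-notAll; filter-none; upTo-∷ʳ; applyUpTo-∷ʳ; drop-map; take-map; drop-drop)
open import Data.List.Membership.Propositional using (_∈_)
open import Data.List.Membership.Propositional.Properties using (∈-map⁺; ∈-map⁻; ∈-upTo⁺; ∈-upTo⁻; ∈-∃++; ∈-applyUpTo⁻)
open import Data.List.Relation.Unary.Any as Any using (here; there)
open import Data.List.Relation.Unary.All as All using (All; []; _∷_)
import Data.List.Relation.Unary.All.Properties as All
open import Data.List.Relation.Unary.Linked using (Linked; [-]; _∷_)
import Data.List.Relation.Unary.Linked.Properties as Linked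
open import Data.List.Relation.Unary.Unique.Propositional using (Unique; []; _∷_)
import Data.List.Relation.Unary.Unique.Propositional.Properties as Unique
open import Data.List.Relation.Binary.Permutation.Propositional using (_↭_; ↭-refl; ↭-prep; ↭-trans; ↭-sym; ↭⇒↭ₛ)
open import Data.List.Relation.Binary.Permutation.Propositional.Properties using (↭-length; ∈-resp-↭; filter-↭; shift)
open import Data.List.Relation.Binary.Permutation.Setoid.Properties using (Unique-resp-↭)
open import Data.List.Relation.Binary.Sublist.Propositional.Properties using (take-⊆; drop-⊆; Any-resp-⊆)
open import Data.Maybe using (just)
open import Data.Maybe.Properties using (just-injective)
open import Data.Product using (Σ; _×_; ∃; _,_; proj₁; proj₂)
open import Data.Sum using (_⊎_; inj₁; inj₂)
open import Data.Empty using (⊥-elim)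
open import Function using (_∘_; _⇔_; mk⇔; Equivalence)
open import Level using (0ℓ)
open import Relation.Nullary using (¬_; yes; no)
open import Relation.Unary using (Pred; Decidable)
open import Relation.Binary.Definitions using (tri<; tri≈; tri>)
open import Relation.Binary.PropositionalEquality
  using (_≡_; _≢_; refl; sym; trans; cong; cong₂; subst; subst₂; setoid; module ≡-Reasoning)

module _ {A : Set} {P Q : Pred A 0ℓ} (P? : Decidable P) (Q? : Decidable Q) where

  length-filter-mono-∈ : ∀ xs → (∀ {x} → x ∈ xs → P x → Q x) →
    length (filter P? xs) ≤ length (filter Q? xs)
  length-filter-mono-∈ [] _ = z≤n
  length-filter-mono-∈ (x ∷ xs) P⇒Q with P? x | Q? x
  ... | yes px | yes _  = s≤s (length-filter-mono-∈ xs (P⇒Q ∘ there))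
  ... | yes px | no ¬qx = ⊥-elim (¬qx (P⇒Q (here refl) px))
  ... | no _   | yes _  = m≤n⇒m≤1+n (length-filter-mono-∈ xs (P⇒Q ∘ there))
  ... | no _   | no _   = length-filter-mono-∈ xs (P⇒Q ∘ there)

  length-filter-mono-<-∈ : ∀ xs → (∀ {x} → x ∈ xs → P x → Q x) →
    ∀ {y} → y ∈ xs → Q y → ¬ P y → length (filter P? xs) < length (filter Q? xs)
  length-filter-mono-<-∈ (x ∷ xs) P⇒Q (here refl) qy ¬py with P? x | Q? x
  ... | yes py | _      = ⊥-elim (¬py py)
  ... | no _   | yes _  = s≤s (length-filter-mono-∈ xs (P⇒Q ∘ there))
  ... | no _   | no ¬qy = ⊥-elim (¬qy qy)
  length-filter-mono-<-∈ (x ∷ xs) P⇒Q (there y∈) qy ¬py with P? x | Q? x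
  ... | yes _  | yes _  = s≤s (length-filter-mono-<-∈ xs (P⇒Q ∘ there) y∈ qy ¬py)
  ... | yes px | no ¬qx = ⊥-elim (¬qx (P⇒Q (here refl) px))
  ... | no _   | yes _  = m≤n⇒m≤1+n (length-filter-mono-<-∈ xs (P⇒Q ∘ there) y∈ qy ¬py)
  ... | no _   | no _   = length-filter-mono-<-∈ xs (P⇒Q ∘ there) y∈ qy ¬py

length-filter-cong-∈ : {A : Set} {P Q : Pred A 0ℓ} (P? : Decidable P) (Q? : Decidable Q) →
  ∀ xs → (∀ {x} → x ∈ xs → P x ⇔ Q x) → length (filter P? xs) ≡ length (filter Q? xs)
length-filter-cong-∈ P? Q? xs P⇔Q = ≤-antisym
  (length-filter-mono-∈ P? Q? xs (Equivalence.to ∘ P⇔Q))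
  (length-filter-mono-∈ Q? P? xs (Equivalence.from ∘ P⇔Q))

length-filter-map : {A B : Set} {P : Pred B 0ℓ} (P? : Decidable P) (f : A → B) (xs : List A) →
  length (filter P? (map f xs)) ≡ length (filter (P? ∘ f) xs)
length-filter-map P? f [] = refl
length-filter-map P? f (x ∷ xs) with P? (f x)
... | yes _ = cong suc (length-filter-map P? f xs)
... | no _  = length-filter-map P? f xs

below : ℕ → List ℕ → ℕ
below x xs = length (filter (_<? x) xs)

below-mono : ∀ {x y} xs → x ≤ y → below x xs ≤ below y xs
below-mono xs x≤y = length-filter-mono-∈ (_<? _) (_<? _) xs (λ _ i<x → <-≤-trans i<x x≤y)

below-mono-< : ∀ {x y} xs → x < y → x ∈ xs → below x xs < below y xs
below-mono-< xs x<y x∈xs = length-filter-mono-<-∈ (_<? _) (_<? _) xs (λ _ i<x → <-trans i<x x<y) x∈xs x<y (<-irrefl refl)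

below-<-length : ∀ {x} xs → x ∈ xs → below x xs < length xs
below-<-length xs x∈xs = filter-notAll (_<? _) xs (Any.map (λ { refl → <-irrefl refl }) x∈xs)

below-≡-length : ∀ {x} xs → All (_< x) xs → below x xs ≡ length xs
below-≡-length xs all< = cong length (filter-all (_<? _) all<)

below-≡-0 : ∀ {x} xs → All (λ y → ¬ y < x) xs → below x xs ≡ 0
below-≡-0 xs none< = cong length (filter-none (_<? _) none<)

below-↭ : ∀ {x xs ys} → xs ↭ ys → below x xs ≡ below x ys
below-↭ xs↭ys = ↭-length (filter-↭ (_<? _) xs↭ys)

below-∷ʳ : ∀ {x y} xs → x ≤ y → below x (xs ∷ʳ y) ≡ below x xs
below-∷ʳ {x} {y} xs x≤y = begin
  below x (xs ∷ʳ y)                                        ≡⟨ cong length (filter-++ (_<? x) xs [ y ]) ⟩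
  length (filter (_<? x) xs ++ filter (_<? x) [ y ])      ≡⟨ length-++ (filter (_<? x) xs) ⟩
  below x xs + below x [ y ]                              ≡⟨ cong (below x xs +_) (below-≡-0 [ y ] (≤⇒≯ x≤y ∷ [])) ⟩
  below x xs + 0                                          ≡⟨ +-identityʳ _ ⟩
  below x xs                                              ∎
  where open ≡-Reasoning

below-upTo : ∀ {c} L → c ≤ L → below c (upTo L) ≡ c
below-upTo zero z≤n = refl
below-upTo {c} (suc L) c≤1+L with m≤n⇒m<n∨m≡n c≤1+L
... | inj₂ refl = trans (below-≡-length (upTo (suc L)) (All.tabulate ∈-upTo⁻)) (length-upTo (suc L))
... | inj₁ c<1+L = begin
  below c (upTo (suc L))   ≡⟨ cong (below c) (sym (upTo-∷ʳ L)) ⟩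
  below c (upTo L ∷ʳ L)    ≡⟨ below-∷ʳ (upTo L) (≤-pred c<1+L) ⟩
  below c (upTo L)         ≡⟨ below-upTo L (≤-pred c<1+L) ⟩
  c                        ∎
  where open ≡-Reasoning

below-1+upTo : ∀ {c} L → c ≤ L → below (suc c) (map suc (upTo L)) ≡ c
below-1+upTo {c} L c≤L = begin
  below (suc c) (map suc (upTo L))                  ≡⟨ length-filter-map (_<? suc c) suc (upTo L) ⟩
  length (filter (λ i → suc i <? suc c) (upTo L))  ≡⟨ length-filter-cong-∈ _ (_<? c) (upTo L) (λ _ → mk⇔ ≤-pred s≤s) ⟩
  below c (upTo L)                                  ≡⟨ below-upTo L c≤L ⟩
  c                                                 ∎
  where open ≡-Reasoning

-- Zero-based indexing; the junk value 0 past the end is never used.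
at : List ℕ → ℕ → ℕ
at []       _       = 0
at (x ∷ xs) zero    = x
at (x ∷ xs) (suc i) = at xs i

applyUpTo-at : (xs : List ℕ) → applyUpTo (at xs) (length xs) ≡ xs
applyUpTo-at []       = refl
applyUpTo-at (x ∷ xs) = cong (x ∷_) (applyUpTo-at xs)

at-applyUpTo : ∀ (f : ℕ → ℕ) {L j} → j < L → at (applyUpTo f L) j ≡ f j
at-applyUpTo f {suc L} {zero}  _         = refl
at-applyUpTo f {suc L} {suc j} (s≤s j<L) = at-applyUpTo (f ∘ suc) j<L

at-drop : ∀ k (xs : List ℕ) j → at (drop k xs) j ≡ at xs (k + j)
at-drop zero    xs       j = refl
at-drop (suc k) []       j = refl
at-drop (suc k) (x ∷ xs) j = at-drop k xs j

at-take : ∀ {p} (xs : List ℕ) {j} → j < p → at (take p xs) j ≡ at xs j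
at-take {suc p} []       _         = refl
at-take {suc p} (x ∷ xs) {zero}  _ = refl
at-take {suc p} (x ∷ xs) {suc j} (s≤s j<p) = at-take xs j<p

at-map : ∀ (f : ℕ → ℕ) (xs : List ℕ) {j} → j < length xs → at (map f xs) j ≡ f (at xs j)
at-map f (x ∷ xs) {zero}  _         = refl
at-map f (x ∷ xs) {suc j} (s≤s j<l) = at-map f xs j<l

at-∈ : ∀ (xs : List ℕ) {j} → j < length xs → at xs j ∈ xs
at-∈ (x ∷ xs) {zero}  _         = here refl
at-∈ (x ∷ xs) {suc j} (s≤s j<l) = there (at-∈ xs j<l)

∈-take⇒at : ∀ q (xs : List ℕ) {x} → x ∈ take q xs → ∃ λ t → t < q × t < length xs × at xs t ≡ x
∈-take⇒at (suc q) (y ∷ xs) (here refl) = 0 , z<s , z<s , refl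
∈-take⇒at (suc q) (y ∷ xs) (there x∈) with ∈-take⇒at q xs x∈
... | t , t<q , t<l , eq = suc t , s<s t<q , s<s t<l , eq

at-injective : ∀ {xs : List ℕ} → Unique xs → ∀ {t t′} → t < length xs → t′ < length xs → at xs t ≡ at xs t′ → t ≡ t′
at-injective {x ∷ xs} _           {zero}  {zero}   _         _          _  = refl
at-injective {x ∷ xs} (x≢ ∷ _)    {zero}  {suc t′} _         (s≤s t′<) eq = ⊥-elim (All.lookup x≢ (at-∈ xs t′<) eq)
at-injective {x ∷ xs} (x≢ ∷ _)    {suc t} {zero}   (s≤s t<)  _          eq = ⊥-elim (All.lookup x≢ (at-∈ xs t<) (sym eq))
at-injective {x ∷ xs} (_ ∷ xs!)   {suc t} {suc t′} (s≤s t<)  (s≤s t′<) eq = cong suc (at-injective xs! t< t′< eq)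

head-drop : ∀ p (xs : List ℕ) → p < length xs → head (drop p xs) ≡ just (at xs p)
head-drop zero    (x ∷ xs) _         = refl
head-drop (suc p) (x ∷ xs) (s≤s p<l) = head-drop p xs p<l

take-suc-at : ∀ q (xs : List ℕ) → q < length xs → take (suc q) xs ≡ take q xs ∷ʳ at xs q
take-suc-at zero    (x ∷ xs) _         = refl
take-suc-at (suc q) (x ∷ xs) (s≤s q<l) = cong (x ∷_) (take-suc-at q xs q<l)

length-take-≤ : ∀ p (xs : List ℕ) → p ≤ length xs → length (take p xs) ≡ p
length-take-≤ p xs p≤l = trans (length-take p xs) (m≤n⇒m⊓n≡m p≤l)

drop-take : ∀ i m (ys : List ℕ) → drop i (take m ys) ≡ take (m ∸ i) (drop i ys)
drop-take zero    m       ys       = refl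
drop-take (suc i) zero    ys       = refl
drop-take (suc i) (suc m) []       = sym (take-[] (m ∸ i))
drop-take (suc i) (suc m) (y ∷ ys) = drop-take i m ys

applyUpTo-cong : {A : Set} {f g : ℕ → A} (L : ℕ) → (∀ {j} → j < L → f j ≡ g j) → applyUpTo f L ≡ applyUpTo g L
applyUpTo-cong zero    f≡g = refl
applyUpTo-cong (suc L) f≡g = cong₂ _∷_ (f≡g z<s) (applyUpTo-cong L (f≡g ∘ s<s))

take-applyUpTo : {A : Set} (f : ℕ → A) {m L : ℕ} → m ≤ L → take m (applyUpTo f L) ≡ applyUpTo f m
take-applyUpTo f z≤n       = refl
take-applyUpTo f (s≤s m≤L) = cong (f 0 ∷_) (take-applyUpTo (f ∘ suc) m≤L)

-- Standardisation

-- st xs is map (rank xs) xs, definitionally.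
rank : List ℕ → ℕ → ℕ
rank xs c = suc (below c xs)

rank-mono-< : ∀ {u v} xs → u ∈ xs → u < v → rank xs u < rank xs v
rank-mono-< xs u∈xs u<v = s≤s (below-mono-< xs u<v u∈xs)

rank-<⇔ : ∀ {u v} xs → u ∈ xs → v ∈ xs → rank xs u < rank xs v ⇔ u < v
rank-<⇔ {u} {v} xs u∈xs v∈xs = mk⇔ reflects (rank-mono-< xs u∈xs)
  where
  reflects : rank xs u < rank xs v → u < v
  reflects r< with <-cmp u v
  ... | tri< u<v _ _   = u<v
  ... | tri≈ _ refl _  = ⊥-elim (<-irrefl refl r<)
  ... | tri> _ _ v<u   = ⊥-elim (<-asym r< (rank-mono-< xs v∈xs v<u))

st-map-cong : {A : Set} (f g : A → ℕ) (I : List A) →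
  (∀ {i j} → i ∈ I → j ∈ I → f i < f j ⇔ g i < g j) → st (map f I) ≡ st (map g I)
st-map-cong f g I f⇔g = begin
  st (map f I)                        ≡⟨ sym (map-∘ I) ⟩
  map (rank (map f I) ∘ f) I          ≡⟨ map-cong-local (All.tabulate (cong suc ∘ below-eq)) ⟩
  map (rank (map g I) ∘ g) I          ≡⟨ map-∘ I ⟩
  st (map g I)                        ∎
  where
  open ≡-Reasoning
  below-eq : ∀ {i} → i ∈ I → below (f i) (map f I) ≡ below (g i) (map g I)
  below-eq {i} i∈I = begin
    below (f i) (map f I)                 ≡⟨ length-filter-map _ f I ⟩
    length (filter (λ j → f j <? f i) I)  ≡⟨ length-filter-cong-∈ _ _ I (λ j∈I → f⇔g j∈I i∈I) ⟩
    length (filter (λ j → g j <? g i) I)  ≡⟨ sym (length-filter-map _ g I) ⟩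
    below (g i) (map g I)                 ∎

st-map-order-iso : (h : ℕ → ℕ) (zs : List ℕ) →
  (∀ {u v} → u ∈ zs → v ∈ zs → h u < h v ⇔ u < v) → st (map h zs) ≡ st zs
st-map-order-iso h zs h⇔ = trans (st-map-cong h (λ z → z) zs h⇔) (cong st (map-id zs))

st-map-rank-⊆ : (xs zs : List ℕ) → (∀ {z} → z ∈ zs → z ∈ xs) → st (map (rank xs) zs) ≡ st zs
st-map-rank-⊆ xs zs zs⊆xs = st-map-order-iso (rank xs) zs (λ u∈ v∈ → rank-<⇔ xs (zs⊆xs u∈) (zs⊆xs v∈))

st-drop-st : ∀ i ys → st (drop i (st ys)) ≡ st (drop i ys)
st-drop-st i ys = trans (cong st (drop-map i ys)) (st-map-rank-⊆ ys (drop i ys) (Any-resp-⊆ (drop-⊆ i ys)))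

st-take-st : ∀ i ys → st (take i (st ys)) ≡ st (take i ys)
st-take-st i ys = trans (cong st (take-map i ys)) (st-map-rank-⊆ ys (take i ys) (Any-resp-⊆ (take-⊆ i ys)))

Unique-map⁺-∈ : (f : ℕ → ℕ) {xs : List ℕ} → (∀ {u v} → u ∈ xs → v ∈ xs → f u ≡ f v → u ≡ v) →
  Unique xs → Unique (map f xs)
Unique-map⁺-∈ f {[]} _ [] = []
Unique-map⁺-∈ f {x ∷ xs} inj (x≢xs ∷ xs!) =
  All.map⁺ (All.tabulate λ {y} y∈xs fx≡fy → All.lookup x≢xs y∈xs (inj (here refl) (there y∈xs) fx≡fy))
  ∷ Unique-map⁺-∈ f (λ u∈ v∈ → inj (there u∈) (there v∈)) xs!

st-unique : ∀ {w} → Unique w → Unique (st w)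
st-unique {w} w! = Unique-map⁺-∈ (rank w) injective w!
  where
  injective : ∀ {u v} → u ∈ w → v ∈ w → rank w u ≡ rank w v → u ≡ v
  injective {u} {v} u∈w v∈w eq with <-cmp u v
  ... | tri< u<v _ _ = ⊥-elim (<-irrefl eq (rank-mono-< w u∈w u<v))
  ... | tri≈ _ u≡v _ = u≡v
  ... | tri> _ _ v<u = ⊥-elim (<-irrefl (sym eq) (rank-mono-< w v∈w v<u))

unique-⊆⇒↭ : ∀ {xs ys : List ℕ} → Unique xs → Unique ys → (∀ {z} → z ∈ xs → z ∈ ys) →
  length ys ≤ length xs → xs ↭ ys
unique-⊆⇒↭ {[]} {[]} _ _ _ _ = ↭-refl
unique-⊆⇒↭ {x ∷ xs} (x≢xs ∷ xs!) ys! xs⊆ys len with ∈-∃++ (xs⊆ys (here refl))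
... | l , r , refl = ↭-trans (↭-prep x (unique-⊆⇒↭ xs! l++r! xs⊆l++r len′)) (↭-sym (shift x l r))
  where
  l++r! : Unique (l ++ r)
  l++r! with Unique-resp-↭ (setoid ℕ) (↭⇒↭ₛ (shift x l r)) ys!
  ... | _ ∷ l++r! = l++r!
  xs⊆l++r : ∀ {z} → z ∈ xs → z ∈ l ++ r
  xs⊆l++r z∈xs with ∈-resp-↭ (shift x l r) (xs⊆ys (there z∈xs))
  ... | here refl   = ⊥-elim (All.lookup x≢xs z∈xs refl)
  ... | there z∈l++r = z∈l++r
  len′ : length (l ++ r) ≤ length xs
  len′ = ≤-pred (subst (_≤ suc (length xs)) (↭-length (shift x l r)) len)

Unique-1…n : ∀ n → Unique (map suc (upTo n))
Unique-1…n n = Unique.map⁺ suc-injective (Unique.upTo⁺ n)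

st-isPerm : ∀ {w} → Unique w → IsPerm (length w) (st w)
st-isPerm {w} w! = unique-⊆⇒↭ (st-unique w!) (Unique-1…n (length w)) st⊆ length-eq
  where
  st⊆ : ∀ {z} → z ∈ st w → z ∈ map suc (upTo (length w))
  st⊆ z∈ with ∈-map⁻ (rank w) z∈
  ... | v , v∈w , refl = ∈-map⁺ suc (∈-upTo⁺ (below-<-length w v∈w))
  length-eq : length (map suc (upTo (length w))) ≤ length (st w)
  length-eq = ≤-reflexive (trans (length-map suc (upTo (length w))) (trans (length-upTo (length w)) (sym (length-map (rank w) w))))

IsPerm⇒Unique : ∀ {n a} → IsPerm n a → Unique a
IsPerm⇒Unique {n} a↭ = Unique-resp-↭ (setoid ℕ) (↭⇒↭ₛ (↭-sym a↭)) (Unique-1…n n)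

IsPerm⇒length : ∀ {n a} → IsPerm n a → length a ≡ n
IsPerm⇒length {n} a↭ = trans (↭-length a↭) (trans (length-map suc (upTo n)) (length-upTo n))

st-perm : ∀ {n a} → IsPerm n a → st a ≡ a
st-perm {n} {a} a↭ = map-id-local (All.tabulate (rank-self ∘ ∈-resp-↭ a↭))
  where
  rank-self : ∀ {c} → c ∈ map suc (upTo n) → rank a c ≡ c
  rank-self c∈ with ∈-map⁻ suc c∈
  ... | i , i∈ , refl = cong suc (trans (below-↭ a↭) (below-1+upTo n (<⇒≤ (∈-upTo⁻ i∈))))

module _ {L : ℕ} (f g : ℕ → ℕ) (mono : ∀ {i j} → i < L → j < L → g i < g j → f i < f j)
         (g-injective : ∀ {i j} → i < L → j < L → g i ≡ g j → i ≡ j) where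

  mono-injective : ∀ {i j} → i < L → j < L → i ≢ j → f i ≢ f j
  mono-injective {i} {j} i<L j<L i≢j eq with <-cmp (g i) (g j)
  ... | tri< gi<gj _ _ = <-irrefl eq (mono i<L j<L gi<gj)
  ... | tri≈ _ gi≡gj _ = i≢j (g-injective i<L j<L gi≡gj)
  ... | tri> _ _ gj<gi = <-irrefl (sym eq) (mono j<L i<L gj<gi)

  mono-reflects : ∀ {i j} → i < L → j < L → f i < f j → g i < g j
  mono-reflects {i} {j} i<L j<L fi<fj with <-cmp (g i) (g j)
  ... | tri< gi<gj _ _ = gi<gj
  ... | tri≈ _ gi≡gj _ = ⊥-elim (<-irrefl (cong f (g-injective i<L j<L gi≡gj)) fi<fj)
  ... | tri> _ _ gj<gi = ⊥-elim (<-asym fi<fj (mono j<L i<L gj<gi))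

  st-applyUpTo-mono : st (applyUpTo f L) ≡ st (applyUpTo g L)
  st-applyUpTo-mono = begin
    st (applyUpTo f L)     ≡⟨ cong st (map-upTo f L) ⟨
    st (map f (upTo L))    ≡⟨ st-map-cong f g (upTo L) f⇔g ⟩
    st (map g (upTo L))    ≡⟨ cong st (map-upTo g L) ⟩
    st (applyUpTo g L)     ∎
    where
    open ≡-Reasoning
    f⇔g : ∀ {i j} → i ∈ upTo L → j ∈ upTo L → f i < f j ⇔ g i < g j
    f⇔g i∈ j∈ = mk⇔ (mono-reflects (∈-upTo⁻ i∈) (∈-upTo⁻ j∈)) (mono (∈-upTo⁻ i∈) (∈-upTo⁻ j∈))

below-st : ∀ {xs θ} → Unique xs → θ ≤ length xs → below (suc θ) (st xs) ≡ θ
below-st {xs} xs! θ≤ = trans (below-↭ (st-isPerm xs!)) (below-1+upTo (length xs) θ≤)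

-- Walks in G(n)

edge-overlap : ∀ {n x w} → Edge n x w → st (drop 1 x) ≡ st (take (n ∸ 1) w)
edge-overlap {n} (c , _ , refl , refl) = begin
  st (drop 1 (st (take n c)))        ≡⟨ st-drop-st 1 (take n c) ⟩
  st (drop 1 (take n c))             ≡⟨ cong st (drop-take 1 n c) ⟩
  st (take (n ∸ 1) (drop 1 c))       ≡⟨ sym (st-take-st (n ∸ 1) (drop 1 c)) ⟩
  st (take (n ∸ 1) (st (drop 1 c)))  ∎
  where open ≡-Reasoning

data Walk (n : ℕ) : ℕ → List ℕ → List ℕ → Set where
  ε   : ∀ {x} → Walk n 0 x x
  _◅_ : ∀ {j x y z} → Edge n x y → Walk n j y z → Walk n (suc j) x z

infixr 5 _◅_

_◅◅_ : ∀ {n i j x y z} → Walk n i x y → Walk n j y z → Walk n (i + j) x z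
ε       ◅◅ w = w
(e ◅ v) ◅◅ w = e ◅ (v ◅◅ w)

walk-overlap : ∀ {n j x z} → Walk n (suc j) x z → st (drop (suc j) x) ≡ st (take (n ∸ suc j) z)
walk-overlap (e ◅ ε) = edge-overlap e
walk-overlap {n} {suc j} {x} {z} (_◅_ {y = y} e w) = begin
  st (drop (2 + j) x)                               ≡⟨ cong st (sym (drop-drop 1 (suc j) x)) ⟩
  st (drop (suc j) (drop 1 x))                      ≡⟨ sym (st-drop-st (suc j) (drop 1 x)) ⟩
  st (drop (suc j) (st (drop 1 x)))                 ≡⟨ cong (st ∘ drop (suc j)) (edge-overlap e) ⟩
  st (drop (suc j) (st (take (n ∸ 1) y)))           ≡⟨ st-drop-st (suc j) (take (n ∸ 1) y) ⟩
  st (drop (suc j) (take (n ∸ 1) y))                ≡⟨ cong st (drop-take (suc j) (n ∸ 1) y) ⟩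
  st (take m (drop (suc j) y))                      ≡⟨ sym (st-take-st m (drop (suc j) y)) ⟩
  st (take m (st (drop (suc j) y)))                 ≡⟨ cong (st ∘ take m) (walk-overlap w) ⟩
  st (take m (st (take (n ∸ suc j) z)))             ≡⟨ st-take-st m (take (n ∸ suc j) z) ⟩
  st (take m (take (n ∸ suc j) z))                  ≡⟨ cong st (take-take m (n ∸ suc j) z) ⟩
  st (take (m ⊓ (n ∸ suc j)) z)                     ≡⟨ cong (λ l → st (take l z)) (m≤n⇒m⊓n≡m m≤) ⟩
  st (take m z)                                     ≡⟨ cong (λ l → st (take l z)) (∸-+-assoc n 1 (suc j)) ⟩
  st (take (n ∸ (2 + j)) z)                         ∎
  where
  open ≡-Reasoning
  m = n ∸ 1 ∸ suc j
  m≤ : m ≤ n ∸ suc j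
  m≤ = ∸-monoˡ-≤ (suc j) (m∸n≤m n 1)

Linked⇒Walk : ∀ {n} x ys z → Linked (Edge n) (x ∷ ys ++ [ z ]) → Walk n (suc (length ys)) x z
Linked⇒Walk x []       z (e ∷ [-]) = e ◅ ε
Linked⇒Walk x (y ∷ ys) z (e ∷ l)   = e ◅ Linked⇒Walk y ys z l

Linked-split : ∀ {n} xs y zs → Linked (Edge n) (xs ++ y ∷ zs) →
  Linked (Edge n) (xs ++ [ y ]) × Linked (Edge n) (y ∷ zs)
Linked-split []           y zs l       = [-] , l
Linked-split (x ∷ [])     y zs (e ∷ l) = e ∷ [-] , l
Linked-split (x ∷ x′ ∷ xs) y zs (e ∷ l) with Linked-split (x′ ∷ xs) y zs l
... | l₁ , l₂ = e ∷ l₁ , l₂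

closedWalk⇒Walk : ∀ {n k v vs a} → ClosedWalk n k (v ∷ vs) → a ∈ v ∷ vs → Walk n k a a
closedWalk⇒Walk {n} {k} {v} {vs} {a} (len , _ , linked) a∈ with ∈-∃++ a∈
... | [] , r , refl = subst (λ j → Walk n j a a) len (Linked⇒Walk a vs a linked)
... | v ∷ l , r , refl with Linked-split (v ∷ l) a (r ++ [ v ]) (subst (Linked (Edge n)) (cong (v ∷_) (++-assoc l (a ∷ r) [ v ])) linked)
...   | v→a , a→v = subst (λ j → Walk n j a a) len′ (Linked⇒Walk a r v a→v ◅◅ Linked⇒Walk v l a v→a)
  where
  len′ : suc (length r) + suc (length l) ≡ k
  len′ = trans (+-comm (suc (length r)) (suc (length l))) (trans (cong suc (sym (length-++ l))) len)

closedWalk-periodic : ∀ {n k vs a} → 1 ≤ k → ClosedWalk n k vs → a ∈ vs → st (drop k a) ≡ st (take (n ∸ k) a)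
closedWalk-periodic {vs = v ∷ vs} (s≤s z≤n) cw a∈ = walk-overlap (closedWalk⇒Walk cw a∈)

InjectiveBelow : (ℕ → ℕ) → ℕ → Set
InjectiveBelow c L = ∀ {i j} → i < j → j < L → c i ≢ c j

InjectiveBelow-≤ : ∀ {c L L′} → L ≤ L′ → InjectiveBelow c L′ → InjectiveBelow c L
InjectiveBelow-≤ L≤L′ inj i<j j<L = inj i<j (<-≤-trans j<L L≤L′)

module Windows (n : ℕ) (c : ℕ → ℕ) where

  window : ℕ → List ℕ
  window i = st (applyUpTo (λ j → c (i + j)) n)

  st-applyUpTo-isPerm : ∀ i L → InjectiveBelow c (i + L) → IsPerm L (st (applyUpTo (λ j → c (i + j)) L))
  st-applyUpTo-isPerm i L inj = subst (λ l → IsPerm l (st (applyUpTo (λ j → c (i + j)) L))) (length-applyUpTo _ L)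
    (st-isPerm (Unique.applyUpTo⁺₁ _ L (λ j<j′ j′<L → inj (+-monoʳ-< i j<j′) (+-monoʳ-< i j′<L))))

  window-edge : ∀ i → InjectiveBelow c (i + suc n) → Edge n (window i) (window (suc i))
  window-edge i inj = st w , st-applyUpTo-isPerm i (suc n) inj , take-eq , drop-eq
    where
    w = applyUpTo (λ j → c (i + j)) (suc n)
    take-eq : st (take n (st w)) ≡ window i
    take-eq = trans (st-take-st n w) (cong st (take-applyUpTo _ (n≤1+n n)))
    drop-eq : st (drop 1 (st w)) ≡ window (suc i)
    drop-eq = trans (st-drop-st 1 w) (cong st (applyUpTo-cong n (λ {j} _ → cong c (+-suc i j))))

  closedWalk-windows : ∀ k → InjectiveBelow c (n + suc k) → window (suc k) ≡ window 0 →
    ClosedWalk n (suc k) (applyUpTo window (suc k))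
  closedWalk-windows k inj periodic =
    length-applyUpTo window (suc k) ,
    All.applyUpTo⁺₁ window (suc k) (λ i<1+k → st-applyUpTo-isPerm _ n (InjectiveBelow-≤ (window-≤ i<1+k) inj)) ,
    subst (Linked (Edge n)) closing
      (Linked.applyUpTo⁺₁ window (2 + k) (λ 1+i<2+k → window-edge _ (InjectiveBelow-≤ (edge-≤ 1+i<2+k) inj)))
    where
    window-≤ : ∀ {i} → i < suc k → i + n ≤ n + suc k
    window-≤ {i} i<1+k = ≤-trans (+-monoˡ-≤ n (<⇒≤ i<1+k)) (≤-reflexive (+-comm (suc k) n))
    edge-≤ : ∀ {i} → suc i < 2 + k → i + suc n ≤ n + suc k
    edge-≤ {i} (s≤s i<1+k) = begin
      i + suc n   ≡⟨ +-suc i n ⟩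
      suc i + n   ≤⟨ +-monoˡ-≤ n i<1+k ⟩
      suc k + n   ≡⟨ +-comm (suc k) n ⟩
      n + suc k   ∎
      where open ≤-Reasoning
    closing : applyUpTo window (2 + k) ≡ applyUpTo window (suc k) ++ [ window 0 ]
    closing = trans (sym (applyUpTo-∷ʳ window (suc k))) (cong (applyUpTo window (suc k) ∷ʳ_) periodic)

-- Interleaving a with a shifted copy of itself

*+-<-lexˡ : ∀ N {q q′ r r′} → q ≤ q′ → r < r′ → N * q + r < N * q′ + r′
*+-<-lexˡ N q≤q′ r<r′ = +-mono-≤-< (*-monoʳ-≤ N q≤q′) r<r′

*+-<-lexʳ : ∀ N {q q′ r r′} → q < q′ → r < N → N * q + r < N * q′ + r′
*+-<-lexʳ N {q} {q′} {r} {r′} q<q′ r<N = begin-strict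
  N * q + r     <⟨ +-monoʳ-< (N * q) r<N ⟩
  N * q + N     ≡⟨ +-comm (N * q) N ⟩
  N + N * q     ≡⟨ *-suc N q ⟨
  N * suc q     ≤⟨ *-monoʳ-≤ N q<q′ ⟩
  N * q′        ≤⟨ m≤m+n (N * q′) r′ ⟩
  N * q′ + r′   ∎
  where open ≤-Reasoning

*+-injectiveʳ : ∀ N {q q′ r r′} → r < N → r′ < N → N * q + r ≡ N * q′ + r′ → r ≡ r′
*+-injectiveʳ N {q} {q′} {r} {r′} r<N r′<N eq with <-cmp q q′
... | tri< q<q′ _ _ = ⊥-elim (<-irrefl eq (*+-<-lexʳ N q<q′ r<N))
... | tri≈ _ refl _ = +-cancelˡ-≡ (N * q) r r′ eq
... | tri> _ _ q′<q = ⊥-elim (<-irrefl (sym eq) (*+-<-lexʳ N q′<q r′<N))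

block-mono : ∀ {L N K} (A b : ℕ → ℕ) (Os : List ℕ) {O : Pred ℕ 0ℓ} → Decidable O → K < N →
  (∀ {i} → i < L → O i → A i ∈ Os × b i ≡ K) →
  (∀ {i} → i < L → ¬ O i → b i < K) →
  (∀ {i j} → ¬ O i → ¬ O j → A i < A j → b i < b j) →
  ∀ {i j} → i < L → j < L → A i < A j → N * below (A i) Os + b i < N * below (A j) Os + b j
block-mono {N = N} A b Os O? K<N distinguished <K ordered {i} {j} i<L j<L Ai<Aj with O? i | O? j
... | yes oi | _ = *+-<-lexʳ N (below-mono-< Os Ai<Aj (proj₁ (distinguished i<L oi)))
                    (subst (_< N) (sym (proj₂ (distinguished i<L oi))) K<N)
... | no ¬oi | yes oj = *+-<-lexˡ N (below-mono Os (<⇒≤ Ai<Aj))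
                         (subst (b i <_) (sym (proj₂ (distinguished j<L oj))) (<K i<L ¬oi))
... | no ¬oi | no ¬oj = *+-<-lexˡ N (below-mono Os (<⇒≤ Ai<Aj)) (ordered ¬oi ¬oj Ai<Aj)

ClosedWalkSecondEndingIn : ℕ → ℕ → List ℕ → ℕ → Set
ClosedWalkSecondEndingIn n k a v =
  Σ (List ℕ) λ b → (Σ (List (List ℕ)) λ rest → ClosedWalk n k (a ∷ b ∷ rest)) × at b (n ∸ 1) ≡ v

-- C₀ ⋯ C_{n+k-1} has both windows C₀ ⋯ C_{n-1} and C_k ⋯ C_{n+k-1} order-isomorphic to a; they share
-- the p = n - k positions k ⋯ n-1, which is consistent by periodicity.  An entry x of either window
-- goes to block N · (number of overlap values of that window below x).  Inside a block, overlap
-- entries sit at K on top, new entries of the second window at n + x, and the other entries of the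
-- first window at x or at 2n + x according as ρ x < θ or not, so C_n can be made to exceed exactly
-- θ of C₁ ⋯ C_{n-1}.
module Interleaving (n k θ : ℕ) {a : List ℕ} (a↭ : IsPerm n a) (k<n : k < n) (1≤k : 1 ≤ k)
                    (periodic : st (drop k a) ≡ st (take (n ∸ k) a)) where

  p : ℕ
  p = n ∸ k

  A : ℕ → ℕ
  A = at a

  ρ key₁ key₂ : ℕ → ℕ
  ρ x = below x (drop 1 a)
  key₁ x = below x (drop k a)
  key₂ x = below x (take p a)

  K N : ℕ
  K = suc (2 * n + n)
  N = suc K

  lift : ℕ → ℕ
  lift x with ρ x <? θ
  ... | yes _ = x
  ... | no _  = 2 * n + x

  offset₁ offset₂ : ℕ → ℕ
  offset₁ i with i <? k
  ... | yes _ = lift (A i)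
  ... | no _  = K
  offset₂ j with j <? p
  ... | yes _ = K
  ... | no _  = n + A j

  W₁ W₂ C : ℕ → ℕ
  W₁ i = N * key₁ (A i) + offset₁ i
  W₂ j = N * key₂ (A j) + offset₂ j
  C i with i <? n
  ... | yes _ = W₁ i
  ... | no _  = W₂ (i ∸ k)

  length-a : length a ≡ n
  length-a = IsPerm⇒length a↭

  a! : Unique a
  a! = IsPerm⇒Unique a↭

  k≤n : k ≤ n
  k≤n = <⇒≤ k<n

  k+p≡n : k + p ≡ n
  k+p≡n = m+[n∸m]≡n k≤n

  p<n : p < n
  p<n = ∸-monoʳ-< {n} {k} {0} 1≤k k≤n

  <length-a : ∀ {i} → i < n → i < length a
  <length-a = subst (_ <_) (sym length-a)

  A-∈ : ∀ {i} → i < n → A i ∈ a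
  A-∈ i<n = at-∈ a (<length-a i<n)

  1≤A : ∀ {i} → i < n → 1 ≤ A i
  1≤A i<n with ∈-map⁻ suc (∈-resp-↭ a↭ (A-∈ i<n))
  ... | _ , _ , eq = subst (1 ≤_) (sym eq) (s≤s z≤n)

  A≤n : ∀ {i} → i < n → A i ≤ n
  A≤n i<n with ∈-map⁻ suc (∈-resp-↭ a↭ (A-∈ i<n))
  ... | _ , v∈ , eq = subst (_≤ n) (sym eq) (∈-upTo⁻ v∈)

  A-injective : ∀ {i j} → i < n → j < n → A i ≡ A j → i ≡ j
  A-injective i<n j<n = at-injective a! (<length-a i<n) (<length-a j<n)

  applyUpTo-A : applyUpTo A n ≡ a
  applyUpTo-A = trans (cong (applyUpTo A) (sym length-a)) (applyUpTo-at a)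

  length-drop-k : length (drop k a) ≡ p
  length-drop-k = trans (length-drop k a) (cong (_∸ k) length-a)

  length-take-p : length (take p a) ≡ p
  length-take-p = length-take-≤ p a (subst (p ≤_) (sym length-a) (m∸n≤m n k))

  A-∈-drop : ∀ {i} → k ≤ i → i < n → A i ∈ drop k a
  A-∈-drop {i} k≤i i<n = subst (_∈ drop k a) (trans (at-drop k a (i ∸ k)) (cong A (m+[n∸m]≡n k≤i)))
    (at-∈ (drop k a) (subst (i ∸ k <_) (sym length-drop-k) (∸-monoˡ-< i<n k≤i)))

  A-∈-take : ∀ {j} → j < p → A j ∈ take p a
  A-∈-take {j} j<p = subst (_∈ take p a) (at-take a j<p) (at-∈ (take p a) (subst (j <_) (sym length-take-p) j<p))

  ∈-drop⇒late : ∀ {x} → x ∈ drop k a → ∃ λ o → k ≤ o × o < n × x ≡ A o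
  ∈-drop⇒late x∈ with ∈-applyUpTo⁻ (λ t → A (k + t)) (subst (_ ∈_) (sym drop-k-a) x∈)
    where
    drop-k-a : applyUpTo (λ t → A (k + t)) p ≡ drop k a
    drop-k-a = begin
      applyUpTo (λ t → A (k + t)) p                 ≡⟨ applyUpTo-cong p (λ {t} _ → sym (at-drop k a t)) ⟩
      applyUpTo (at (drop k a)) p                   ≡⟨ cong (applyUpTo _) length-drop-k ⟨
      applyUpTo (at (drop k a)) (length (drop k a)) ≡⟨ applyUpTo-at (drop k a) ⟩
      drop k a                                      ∎
      where open ≡-Reasoning
  ... | t , t<p , refl = k + t , m≤m+n k t , subst (k + t <_) k+p≡n (+-monoʳ-< k t<p) , refl

  lift-low : ∀ {x} → ρ x < θ → lift x ≡ x
  lift-low {x} low with ρ x <? θ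
  ... | yes _    = refl
  ... | no ¬low  = ⊥-elim (¬low low)

  lift-high : ∀ {x} → ¬ ρ x < θ → lift x ≡ 2 * n + x
  lift-high {x} ¬low with ρ x <? θ
  ... | yes low = ⊥-elim (¬low low)
  ... | no _    = refl

  lift-< : ∀ {x} → x ≤ n → lift x < K
  lift-< {x} x≤n with ρ x <? θ
  ... | yes _ = s≤s (≤-trans x≤n (m≤n+m n (2 * n)))
  ... | no _  = s≤s (+-monoʳ-≤ (2 * n) x≤n)

  lift-mono : ∀ {x y} → x < y → lift x < lift y
  lift-mono {x} {y} x<y with ρ x <? θ | ρ y <? θ
  ... | yes _    | yes _   = x<y
  ... | yes _    | no _    = <-≤-trans x<y (m≤n+m y (2 * n))
  ... | no ¬lowx | yes lowy = ⊥-elim (¬lowx (≤-<-trans (below-mono (drop 1 a) (<⇒≤ x<y)) lowy))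
  ... | no _     | no _    = +-monoʳ-< (2 * n) x<y

  offset₁-early : ∀ {i} → i < k → offset₁ i ≡ lift (A i)
  offset₁-early {i} i<k with i <? k
  ... | yes _   = refl
  ... | no i≮k  = ⊥-elim (i≮k i<k)

  offset₁-late : ∀ {i} → k ≤ i → offset₁ i ≡ K
  offset₁-late {i} k≤i with i <? k
  ... | yes i<k = ⊥-elim (<⇒≱ i<k k≤i)
  ... | no _    = refl

  offset₂-early : ∀ {j} → j < p → offset₂ j ≡ K
  offset₂-early {j} j<p with j <? p
  ... | yes _   = refl
  ... | no j≮p  = ⊥-elim (j≮p j<p)

  offset₂-late : ∀ {j} → p ≤ j → offset₂ j ≡ n + A j
  offset₂-late {j} p≤j with j <? p
  ... | yes j<p = ⊥-elim (<⇒≱ j<p p≤j)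
  ... | no _    = refl

  n+A<K : ∀ {j} → j < n → n + A j < K
  n+A<K j<n = s≤s (≤-trans (+-monoʳ-≤ n (A≤n j<n)) (+-monoˡ-≤ n (m≤m+n n (n + 0))))

  C-< : ∀ {i} → i < n → C i ≡ W₁ i
  C-< {i} i<n with i <? n
  ... | yes _   = refl
  ... | no i≮n  = ⊥-elim (i≮n i<n)

  C-≥ : ∀ {i} → n ≤ i → C i ≡ W₂ (i ∸ k)
  C-≥ {i} n≤i with i <? n
  ... | yes i<n = ⊥-elim (<⇒≱ i<n n≤i)
  ... | no _    = refl

  W₁-mono : ∀ {i j} → i < n → j < n → A i < A j → W₁ i < W₁ j
  W₁-mono = block-mono A offset₁ (drop k a) (k ≤?_) (n<1+n K)
    (λ i<n k≤i → A-∈-drop k≤i i<n , offset₁-late k≤i)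
    (λ i<n k≰i → subst (_< K) (sym (offset₁-early (≰⇒> k≰i))) (lift-< (A≤n i<n)))
    (λ k≰i k≰j Ai<Aj → subst₂ _<_ (sym (offset₁-early (≰⇒> k≰i))) (sym (offset₁-early (≰⇒> k≰j))) (lift-mono Ai<Aj))

  W₂-mono : ∀ {i j} → i < n → j < n → A i < A j → W₂ i < W₂ j
  W₂-mono = block-mono A offset₂ (take p a) (_<? p) (n<1+n K)
    (λ _ i<p → A-∈-take i<p , offset₂-early i<p)
    (λ i<n i≮p → subst (_< K) (sym (offset₂-late (≮⇒≥ i≮p))) (n+A<K i<n))
    (λ i≮p j≮p Ai<Aj → subst₂ _<_ (sym (offset₂-late (≮⇒≥ i≮p))) (sym (offset₂-late (≮⇒≥ j≮p))) (+-monoʳ-< n Ai<Aj))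

  key-periodic : ∀ {j} → j < p → key₁ (A (k + j)) ≡ key₂ (A j)
  key-periodic {j} j<p = suc-injective (begin
    suc (key₁ (A (k + j)))         ≡⟨ cong (suc ∘ key₁) (at-drop k a j) ⟨
    suc (key₁ (at (drop k a) j))   ≡⟨ at-map (rank (drop k a)) (drop k a) (subst (j <_) (sym length-drop-k) j<p) ⟨
    at (st (drop k a)) j           ≡⟨ cong (λ l → at l j) periodic ⟩
    at (st (take p a)) j           ≡⟨ at-map (rank (take p a)) (take p a) (subst (j <_) (sym length-take-p) j<p) ⟩
    suc (key₂ (at (take p a) j))   ≡⟨ cong (suc ∘ key₂) (at-take a j<p) ⟩
    suc (key₂ (A j))               ∎)
    where open ≡-Reasoning

  C-shift : ∀ {j} → j < n → C (k + j) ≡ W₂ j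
  C-shift {j} j<n with k + j <? n
  ... | no _      = cong W₂ (m+n∸m≡n k j)
  ... | yes k+j<n = cong₂ _+_ (cong (N *_) (key-periodic j<p)) (trans (offset₁-late (m≤m+n k j)) (sym (offset₂-early j<p)))
    where
    j<p : j < p
    j<p = +-cancelˡ-< k j p (subst (k + j <_) (sym k+p≡n) k+j<n)

  C-injective : InjectiveBelow C (n + k)
  C-injective {i} {j} i<j j<n+k eq with n ≤? j | k ≤? i
  ... | no n≰j | _ = mono-injective W₁ A W₁-mono A-injective (<-trans i<j j<n) j<n (<⇒≢ i<j)
                       (trans (sym (C-< (<-trans i<j j<n))) (trans eq (C-< j<n)))
    where j<n = ≰⇒> n≰j
  ... | yes n≤j | yes k≤i = mono-injective W₂ A W₂-mono A-injective i-k<n j-k<n i-k≢j-k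
                              (trans (sym (C-shift i-k<n)) (trans (cong C (m+[n∸m]≡n k≤i)) (trans eq (C-≥ n≤j))))
    where
    j-k<n : j ∸ k < n
    j-k<n = subst (j ∸ k <_) (m+n∸n≡m n k) (∸-monoˡ-< j<n+k (≤-trans k≤n n≤j))
    i-k<n : i ∸ k < n
    i-k<n = ≤-<-trans (∸-monoˡ-≤ k (<⇒≤ i<j)) j-k<n
    i-k≢j-k : i ∸ k ≢ j ∸ k
    i-k≢j-k e = <⇒≢ i<j (trans (sym (m+[n∸m]≡n k≤i)) (trans (cong (k +_) e) (m+[n∸m]≡n (≤-trans k≤i (<⇒≤ i<j)))))
  ... | yes n≤j | no k≰i = lift≢ (*+-injectiveʳ N {key₁ (A i)} {key₂ (A (j ∸ k))} (<-trans (lift-< (A≤n i<n)) (n<1+n K))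
                                (<-trans (n+A<K j-k<n) (n<1+n K)) encodings-equal)
    where
    i<k = ≰⇒> k≰i
    i<n = <-trans i<k k<n
    j-k<n : j ∸ k < n
    j-k<n = subst (j ∸ k <_) (m+n∸n≡m n k) (∸-monoˡ-< j<n+k (≤-trans k≤n n≤j))
    p≤j-k : p ≤ j ∸ k
    p≤j-k = ∸-monoˡ-≤ k n≤j
    encodings-equal : N * key₁ (A i) + lift (A i) ≡ N * key₂ (A (j ∸ k)) + (n + A (j ∸ k))
    encodings-equal = begin
      N * key₁ (A i) + lift (A i)              ≡⟨ cong (N * key₁ (A i) +_) (offset₁-early i<k) ⟨
      W₁ i                                     ≡⟨ C-< i<n ⟨
      C i                                      ≡⟨ eq ⟩
      C j                                      ≡⟨ C-≥ n≤j ⟩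
      W₂ (j ∸ k)                               ≡⟨ cong (N * key₂ (A (j ∸ k)) +_) (offset₂-late p≤j-k) ⟩
      N * key₂ (A (j ∸ k)) + (n + A (j ∸ k))   ∎
      where open ≡-Reasoning
    -- lift never lands in (n, 2n], where the new second-window entries live.
    lift≢ : lift (A i) ≢ n + A (j ∸ k)
    lift≢ eq′ with ρ (A i) <? θ
    ... | yes _ = <-irrefl eq′ (≤-<-trans (A≤n i<n) (m<m+n n (1≤A j-k<n)))
    ... | no _  = <-irrefl (sym eq′) (begin-strict
      n + A (j ∸ k)   ≤⟨ +-monoʳ-≤ n (A≤n j-k<n) ⟩
      n + n           ≡⟨ cong (n +_) (+-identityʳ n) ⟨
      2 * n           <⟨ m<m+n (2 * n) (1≤A i<n) ⟩
      2 * n + A i     ∎)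
      where open ≤-Reasoning

  open Windows n C

  st-applyUpTo-A : (W : ℕ → ℕ) → (∀ {i j} → i < n → j < n → A i < A j → W i < W j) → st (applyUpTo W n) ≡ a
  st-applyUpTo-A W W-mono = begin
    st (applyUpTo W n)   ≡⟨ st-applyUpTo-mono W A W-mono A-injective ⟩
    st (applyUpTo A n)   ≡⟨ cong st applyUpTo-A ⟩
    st a                 ≡⟨ st-perm a↭ ⟩
    a                    ∎
    where open ≡-Reasoning

  window-0 : window 0 ≡ a
  window-0 = trans (cong st (applyUpTo-cong n C-<)) (st-applyUpTo-A W₁ W₁-mono)

  window-k : window k ≡ a
  window-k = trans (cong st (applyUpTo-cong n C-shift)) (st-applyUpTo-A W₂ W₂-mono)

  closedWalk-from-a : ∀ {k′} → k ≡ 2 + k′ → Σ (List (List ℕ)) λ rest → ClosedWalk n k (a ∷ window 1 ∷ rest)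
  closedWalk-from-a {k′} refl = _ , subst (λ v → ClosedWalk n k (v ∷ window 1 ∷ applyUpTo (window ∘ suc ∘ suc) k′))
    window-0 (closedWalk-windows (suc k′) C-injective (trans window-k (sym window-0)))

  Separates : Set
  Separates = ∀ {i} → suc i < n → C (suc i) < C n ⇔ ρ (A (suc i)) < θ

  window-1-last : ∀ {n′} → n ≡ suc n′ → Separates → θ ≤ n′ → at (window 1) n′ ≡ suc θ
  window-1-last {n′} refl separates θ≤n′ = begin
    at (st w) n′            ≡⟨ at-map (rank w) w (subst (n′ <_) (sym (length-applyUpTo f n)) ≤-refl) ⟩
    rank w (at w n′)        ≡⟨ cong (rank w) (at-applyUpTo f ≤-refl) ⟩
    suc (below (C n) w)     ≡⟨ cong suc below-C-n ⟩
    suc θ                   ∎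
    where
    open ≡-Reasoning
    f : ℕ → ℕ
    f j = C (suc j)
    w = applyUpTo f n
    below-C-n : below (C n) w ≡ θ
    below-C-n = begin
      below (C n) w                                                   ≡⟨ cong (below (C n)) (applyUpTo-∷ʳ f n′) ⟨
      below (C n) (applyUpTo f n′ ∷ʳ C n)                             ≡⟨ below-∷ʳ (applyUpTo f n′) ≤-refl ⟩
      below (C n) (applyUpTo f n′)                                    ≡⟨ cong (below (C n)) (map-upTo f n′) ⟨
      below (C n) (map f (upTo n′))                                   ≡⟨ length-filter-map _ f (upTo n′) ⟩
      length (filter (λ j → f j <? C n) (upTo n′))                    ≡⟨ length-filter-cong-∈ _ _ (upTo n′) (separates ∘ s<s ∘ ∈-upTo⁻) ⟩
      length (filter (λ j → ρ (A (suc j)) <? θ) (upTo n′))            ≡⟨ length-filter-map _ (A ∘ suc) (upTo n′) ⟨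
      length (filter (λ x → ρ x <? θ) (map (A ∘ suc) (upTo n′)))      ≡⟨ cong (length ∘ filter (λ x → ρ x <? θ)) drop-1-a ⟩
      length (filter (λ x → ρ x <? θ) (drop 1 a))                     ≡⟨ length-filter-cong-∈ _ _ (drop 1 a) (λ _ → mk⇔ s≤s ≤-pred) ⟩
      length (filter (λ x → rank (drop 1 a) x <? suc θ) (drop 1 a))  ≡⟨ length-filter-map _ _ (drop 1 a) ⟨
      below (suc θ) (st (drop 1 a))                                   ≡⟨ below-st (Unique.drop⁺ 1 a!) θ≤ ⟩
      θ                                                               ∎
      where
      drop-1-a : map (A ∘ suc) (upTo n′) ≡ drop 1 a
      drop-1-a = trans (map-upTo _ n′) (cong (drop 1) applyUpTo-A)
      θ≤ : θ ≤ length (drop 1 a)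
      θ≤ = subst (θ ≤_) (sym (trans (length-drop 1 a) (cong (_∸ 1) length-a))) θ≤n′

  length-drop-1 : length (drop 1 a) ≡ n ∸ 1
  length-drop-1 = trans (length-drop 1 a) (cong (_∸ 1) length-a)

  pred<length-drop-1 : ∀ {i} → suc i < n → i < length (drop 1 a)
  pred<length-drop-1 1+i<n = subst (_ <_) (sym length-drop-1) (∸-monoˡ-< 1+i<n (s≤s z≤n))

  at-st-drop-1 : ∀ {i} → suc i < n → at (st (drop 1 a)) i ≡ suc (ρ (A (suc i)))
  at-st-drop-1 {i} 1+i<n = trans (at-map (rank (drop 1 a)) (drop 1 a) (pred<length-drop-1 1+i<n)) (cong (suc ∘ ρ) (at-drop 1 a i))

  ρ-< : ∀ {i} → suc i < n → ρ (A (suc i)) < n ∸ 1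
  ρ-< {i} 1+i<n = subst (ρ (A (suc i)) <_) length-drop-1 (below-<-length (drop 1 a)
    (subst (_∈ drop 1 a) (at-drop 1 a i) (at-∈ (drop 1 a) (pred<length-drop-1 1+i<n))))

  -- 1 + ρ (A i) is the entry of y = st (a₂ ⋯ aₙ) at zero-based index i - 1, and y has no repeated entries.
  early-if-∈ : ∀ {i} → 1 ≤ i → i < n → suc (ρ (A i)) ∈ take (k ∸ 1) (st (drop 1 a)) → i < k
  early-if-∈ {suc i} _ 1+i<n ∈take with ∈-take⇒at (k ∸ 1) (st (drop 1 a)) ∈take
  ... | t , t<k-1 , t<len , eq = subst (_< k) (cong suc t≡i) (subst (suc t <_) (m+[n∸m]≡n 1≤k) (s≤s t<k-1))
    where
    t≡i : t ≡ i
    t≡i = at-injective (st-unique (Unique.drop⁺ 1 a!)) t<len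
            (subst (i <_) (sym (length-map (rank (drop 1 a)) (drop 1 a))) (pred<length-drop-1 1+i<n))
            (trans eq (sym (at-st-drop-1 1+i<n)))

  z-last : head (drop p (st (take (p + 1) a))) ≡ just (suc (key₂ (A p)))
  z-last = begin
    head (drop p (st (take (p + 1) a)))                    ≡⟨ cong (λ l → head (drop p (st (take l a)))) (+-comm p 1) ⟩
    head (drop p (st (take (suc p) a)))                    ≡⟨ head-drop p (st (take (suc p) a)) p<length-st ⟩
    just (at (st (take (suc p) a)) p)                      ≡⟨ cong just (at-map (rank (take (suc p) a)) (take (suc p) a) p<length) ⟩
    just (rank (take (suc p) a) (at (take (suc p) a) p))   ≡⟨ cong (just ∘ rank (take (suc p) a)) (at-take a (n<1+n p)) ⟩
    just (suc (below (A p) (take (suc p) a)))              ≡⟨ cong (just ∘ suc ∘ below (A p)) (take-suc-at p a (<length-a p<n)) ⟩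
    just (suc (below (A p) (take p a ∷ʳ A p)))             ≡⟨ cong (just ∘ suc) (below-∷ʳ (take p a) ≤-refl) ⟩
    just (suc (key₂ (A p)))                                ∎
    where
    open ≡-Reasoning
    p<length : p < length (take (suc p) a)
    p<length = subst (p <_) (sym (length-take-≤ (suc p) a (<length-a p<n))) (n<1+n p)
    p<length-st : p < length (st (take (suc p) a))
    p<length-st = subst (p <_) (sym (length-map _ (take (suc p) a))) p<length

  key₂-from-z : ∀ {v} → head (drop p (st (take (p + 1) a))) ≡ just v → suc (key₂ (A p)) ≡ v
  key₂-from-z z≡v = just-injective (trans (sym z-last) z≡v)

  C-n : C n ≡ N * key₂ (A p) + (n + A p)
  C-n = trans (C-≥ ≤-refl) (cong (N * key₂ (A p) +_) (offset₂-late ≤-refl))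

  C-early : ∀ {i} → i < k → C i ≡ N * key₁ (A i) + lift (A i)
  C-early {i} i<k = trans (C-< (<-trans i<k k<n)) (cong (N * key₁ (A i) +_) (offset₁-early i<k))

  C-late : ∀ {i} → k ≤ i → i < n → C i ≡ N * key₁ (A i) + K
  C-late {i} k≤i i<n = trans (C-< i<n) (cong (N * key₁ (A i) +_) (offset₁-late k≤i))

  n+A-p≤2n : n + A p ≤ 2 * n
  n+A-p≤2n = ≤-trans (+-monoʳ-≤ n (A≤n p<n)) (≤-reflexive (cong (n +_) (sym (+-identityʳ n))))

  module BottomCase (m : ℕ) (θ≤m-1 : θ ≤ m ∸ 1)
    (small-early : ∀ j → 1 ≤ j → j ≤ m ∸ 1 → j ∈ take (k ∸ 1) (st (drop 1 a)))
    (z-bottom : head (drop p (st (take (p + 1) a))) ≡ just 1) where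

    early : ∀ {i} → 1 ≤ i → i < n → ρ (A i) < m ∸ 1 → i < k
    early 1≤i i<n small = early-if-∈ 1≤i i<n (small-early _ (s≤s z≤n) small)

    C-n-bottom : C n ≡ n + A p
    C-n-bottom = trans C-n (cong (λ q → N * q + (n + A p)) (suc-injective (key₂-from-z z-bottom)))
                 ⊚ cong (_+ (n + A p)) (*-zeroʳ N)
      where _⊚_ = trans

    -- An overlap entry below A i would have smaller ρ, hence would lie among a₂ ⋯ a_k.
    key₁-low : ∀ {i} → ρ (A i) < θ → key₁ (A i) ≡ 0
    key₁-low {i} low = below-≡-0 (drop k a) (All.tabulate not-below)
      where
      not-below : ∀ {x} → x ∈ drop k a → ¬ x < A i
      not-below x∈ x<Ai with ∈-drop⇒late x∈
      ... | o , k≤o , o<n , refl = <⇒≱ (early (≤-trans 1≤k k≤o) o<n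
              (<-≤-trans (≤-<-trans (below-mono (drop 1 a) (<⇒≤ x<Ai)) low) θ≤m-1)) k≤o

    separates : Separates
    separates {i} 1+i<n with suc i <? k
    ... | no i≮k = mk⇔ (λ lt → ⊥-elim (<-asym lt C-n<C-i))
                        (λ low → ⊥-elim (i≮k (early (s≤s z≤n) 1+i<n (<-≤-trans low θ≤m-1))))
      where
      C-n<C-i : C n < C (suc i)
      C-n<C-i = begin-strict
        C n                           ≡⟨ C-n-bottom ⟩
        n + A p                       ≤⟨ n+A-p≤2n ⟩
        2 * n                         <⟨ s≤s (m≤m+n (2 * n) n) ⟩
        K                             ≤⟨ m≤n+m K _ ⟩
        N * key₁ (A (suc i)) + K      ≡⟨ C-late (≮⇒≥ i≮k) 1+i<n ⟨
        C (suc i)                     ∎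
        where open ≤-Reasoning
    ... | yes i<k = mk⇔ to from
      where
      to : C (suc i) < C n → ρ (A (suc i)) < θ
      to lt with ρ (A (suc i)) <? θ
      ... | yes low = low
      ... | no high = ⊥-elim (<-asym lt (begin-strict
        C n                                     ≡⟨ C-n-bottom ⟩
        n + A p                                 ≤⟨ n+A-p≤2n ⟩
        2 * n                                   <⟨ m<m+n (2 * n) (1≤A 1+i<n) ⟩
        2 * n + A (suc i)                       ≡⟨ lift-high high ⟨
        lift (A (suc i))                        ≤⟨ m≤n+m _ _ ⟩
        N * key₁ (A (suc i)) + lift (A (suc i)) ≡⟨ C-early i<k ⟨
        C (suc i)                               ∎))
        where open ≤-Reasoning
      from : ρ (A (suc i)) < θ → C (suc i) < C n
      from low = begin-strict
        C (suc i)                               ≡⟨ C-early i<k ⟩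
        N * key₁ (A (suc i)) + lift (A (suc i)) ≡⟨ cong₂ (λ q r → N * q + r) (key₁-low low) (lift-low low) ⟩
        N * 0 + A (suc i)                       ≡⟨ cong (_+ A (suc i)) (*-zeroʳ N) ⟩
        A (suc i)                               ≤⟨ A≤n 1+i<n ⟩
        n                                       <⟨ m<m+n n (1≤A p<n) ⟩
        n + A p                                 ≡⟨ C-n-bottom ⟨
        C n                                     ∎
        where open ≤-Reasoning

  module TopCase (m : ℕ) (n-m≤θ : n ∸ m ≤ θ)
    (large-early : ∀ j → n ∸ m + 1 ≤ j → j ≤ n ∸ 1 → j ∈ take (k ∸ 1) (st (drop 1 a)))
    (z-top : head (drop p (st (take (p + 1) a))) ≡ just (p + 1)) where

    late-ρ : ∀ {o} → k ≤ o → o < n → ρ (A o) < n ∸ m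
    late-ρ {zero} k≤0 _ = ⊥-elim (<⇒≱ 1≤k k≤0)
    late-ρ {suc o} k≤o o<n with n ∸ m ≤? ρ (A (suc o))
    ... | no small = ≰⇒> small
    ... | yes large = ⊥-elim (<⇒≱ (early-if-∈ (s≤s z≤n) o<n
            (large-early _ (subst (_≤ suc (ρ (A (suc o)))) (+-comm 1 (n ∸ m)) (s≤s large)) (ρ-< o<n))) k≤o)

    C-n-top : C n ≡ N * p + (n + A p)
    C-n-top = trans C-n (cong (λ q → N * q + (n + A p)) (suc-injective (trans (key₂-from-z z-top) (+-comm p 1))))

    separates : Separates
    separates {i} 1+i<n with suc i <? k
    ... | no i≮k = mk⇔ (λ _ → <-≤-trans (late-ρ k≤i 1+i<n) n-m≤θ) (λ _ → C-i<C-n)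
      where
      k≤i = ≮⇒≥ i≮k
      C-i<C-n : C (suc i) < C n
      C-i<C-n = subst₂ _<_ (sym (C-late k≤i 1+i<n)) (sym C-n-top)
        (*+-<-lexʳ N (subst (key₁ (A (suc i)) <_) length-drop-k (below-<-length (drop k a) (A-∈-drop k≤i 1+i<n))) (n<1+n K))
    ... | yes i<k with ρ (A (suc i)) <? θ
    ...   | yes low = mk⇔ (λ _ → low) (λ _ → C-i<C-n)
      where
      C-i<C-n : C (suc i) < C n
      C-i<C-n = subst₂ _<_ (sym (trans (C-early i<k) (cong (N * key₁ (A (suc i)) +_) (lift-low low)))) (sym C-n-top)
        (*+-<-lexˡ N (subst (key₁ (A (suc i)) ≤_) length-drop-k (length-filter _ (drop k a)))
          (≤-<-trans (A≤n 1+i<n) (m<m+n n (1≤A p<n))))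
    ...   | no high = mk⇔ (λ lt → ⊥-elim (<-asym lt C-n<C-i)) (λ low → ⊥-elim (high low))
      where
      -- Every overlap entry has ρ < n - m ≤ θ ≤ ρ (A i), so lies below A i.
      key₁-high : key₁ (A (suc i)) ≡ p
      key₁-high = trans (below-≡-length (drop k a) (All.tabulate below-Ai)) length-drop-k
        where
        below-Ai : ∀ {x} → x ∈ drop k a → x < A (suc i)
        below-Ai x∈ with ∈-drop⇒late x∈
        ... | o , k≤o , o<n , refl = ≰⇒> λ Ai≤Ao →
          <-irrefl refl (<-≤-trans (<-≤-trans (late-ρ k≤o o<n) n-m≤θ) (≤-trans (≮⇒≥ high) (below-mono (drop 1 a) Ai≤Ao)))
      C-n<C-i : C n < C (suc i)
      C-n<C-i = begin-strict
        C n                                      ≡⟨ C-n-top ⟩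
        N * p + (n + A p)                        <⟨ +-monoʳ-< (N * p) (≤-<-trans n+A-p≤2n (m<m+n (2 * n) (1≤A 1+i<n))) ⟩
        N * p + (2 * n + A (suc i))              ≡⟨ cong₂ (λ q r → N * q + r) key₁-high (lift-high high) ⟨
        N * key₁ (A (suc i)) + lift (A (suc i))  ≡⟨ C-early i<k ⟨
        C (suc i)                                ∎
        where open ≤-Reasoning

  walk-via-window-1 : ∀ {k′} → k ≡ 2 + k′ → Separates → θ ≤ n ∸ 1 → ClosedWalkSecondEndingIn n k a (suc θ)
  walk-via-window-1 k≡ separates θ≤ =
    window 1 , closedWalk-from-a k≡ , window-1-last (sym (m+[n∸m]≡n (≤-trans 1≤k k≤n))) separates θ≤

module _ {n k m : ℕ} {a : List ℕ} (a↭ : IsPerm n a) (k<n : k < n) (2≤m : 2 ≤ m) (m≤k : m ≤ k)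
         {vs : List (List ℕ)} (closed : ClosedWalk n k vs) (a∈vs : a ∈ vs) where

  private
    2≤k : 2 ≤ k
    2≤k = ≤-trans 2≤m m≤k
    1≤k : 1 ≤ k
    1≤k = ≤-trans (s≤s z≤n) 2≤k
    k≡2+k-2 : k ≡ 2 + (k ∸ 2)
    k≡2+k-2 = sym (m+[n∸m]≡n 2≤k)
    m-1≤n-1 : m ∸ 1 ≤ n ∸ 1
    m-1≤n-1 = ∸-monoˡ-≤ 1 (≤-trans m≤k (<⇒≤ k<n))
    module I (θ : ℕ) = Interleaving n k θ a↭ k<n 1≤k (closedWalk-periodic 1≤k closed a∈vs)

  bottom-walks : head (drop (n ∸ k) (st (take (n ∸ k + 1) a))) ≡ just 1 →
    (∀ j → 1 ≤ j → j ≤ m ∸ 1 → j ∈ take (k ∸ 1) (st (drop 1 a))) →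
    (r : Fin m) → ClosedWalkSecondEndingIn n k a (suc (toℕ r))
  bottom-walks z-bottom small-early r =
    I.walk-via-window-1 θ k≡2+k-2 (I.BottomCase.separates θ m θ≤m-1 small-early z-bottom) (≤-trans θ≤m-1 m-1≤n-1)
    where
    θ = toℕ r
    θ≤m-1 : θ ≤ m ∸ 1
    θ≤m-1 = ∸-monoˡ-≤ 1 (toℕ<n r)

  top-walks : head (drop (n ∸ k) (st (take (n ∸ k + 1) a))) ≡ just (n ∸ k + 1) →
    (∀ j → n ∸ m + 1 ≤ j → j ≤ n ∸ 1 → j ∈ take (k ∸ 1) (st (drop 1 a))) →
    (r : Fin m) → ClosedWalkSecondEndingIn n k a (suc (n ∸ m + toℕ r))
  top-walks z-top large-early r =
    I.walk-via-window-1 θ k≡2+k-2 (I.TopCase.separates θ m (m≤m+n (n ∸ m) (toℕ r)) large-early z-top) θ≤n-1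
    where
    θ = n ∸ m + toℕ r
    θ≤n-1 : θ ≤ n ∸ 1
    θ≤n-1 = begin
      n ∸ m + toℕ r   ≤⟨ +-monoʳ-≤ (n ∸ m) (∸-monoˡ-≤ 1 (toℕ<n r)) ⟩
      n ∸ m + (m ∸ 1) ≡⟨ +-∸-assoc (n ∸ m) (≤-trans (s≤s z≤n) 2≤m) ⟨
      n ∸ m + m ∸ 1   ≡⟨ cong (_∸ 1) (m∸n+n≡m (≤-trans m≤k (<⇒≤ k<n))) ⟩
      n ∸ 1           ∎
      where open ≤-Reasoning

distinct-second-vertices : ∀ {n k m a} (θ : Fin m → ℕ) → (∀ {r s} → θ r ≡ θ s → r ≡ s) →
  (∀ r → ClosedWalkSecondEndingIn n k a (suc (θ r))) →
  Σ (Fin m → List ℕ) λ b →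
    (∀ r s → r ≢ s → b r ≢ b s) × (∀ r → Σ (List (List ℕ)) λ rest → ClosedWalk n k (a ∷ b r ∷ rest))
distinct-second-vertices {n} θ θ-injective walk = proj₁ ∘ walk , distinct , proj₁ ∘ proj₂ ∘ walk
  where
  distinct : ∀ r s → r ≢ s → proj₁ (walk r) ≢ proj₁ (walk s)
  distinct r s r≢s eq = r≢s (θ-injective (suc-injective
    (trans (sym (proj₂ (proj₂ (walk r)))) (trans (cong (λ b → at b (n ∸ 1)) eq) (proj₂ (proj₂ (walk s)))))))

theorem3p8 : (n k m : ℕ) → k < n → n < 2 * k → 2 ≤ m → m ≤ k →
    (a : List ℕ) → IsPerm n a →
    (Σ (List (List ℕ)) λ vs → ClosedWalk n k vs × a ∈ vs) →
    ((head (drop (n ∸ k) (st (take (n ∸ k + 1) a))) ≡ just 1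
        × (∀ j → 1 ≤ j → j ≤ m ∸ 1 → j ∈ take (k ∸ 1) (st (drop 1 a))))
     ⊎ (head (drop (n ∸ k) (st (take (n ∸ k + 1) a))) ≡ just (n ∸ k + 1)
        × (∀ j → n ∸ m + 1 ≤ j → j ≤ n ∸ 1 → j ∈ take (k ∸ 1) (st (drop 1 a))))) →
    Σ (Fin m → List ℕ) λ b →
      (∀ r s → r ≢ s → b r ≢ b s)
      × (∀ r → Σ (List (List ℕ)) λ rest → ClosedWalk n k (a ∷ b r ∷ rest))
theorem3p8 n k m k<n _ 2≤m m≤k a a↭ (_ , closed , a∈vs) (inj₁ (z-bottom , small-early)) =
  distinct-second-vertices toℕ toℕ-injective
    (bottom-walks a↭ k<n 2≤m m≤k closed a∈vs z-bottom small-early)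
theorem3p8 n k m k<n _ 2≤m m≤k a a↭ (_ , closed , a∈vs) (inj₂ (z-top , large-early)) =
  distinct-second-vertices (λ r → n ∸ m + toℕ r) (toℕ-injective ∘ +-cancelˡ-≡ (n ∸ m) _ _)
    (top-walks a↭ k<n 2≤m m≤k closed a∈vs z-top large-early)
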